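{- Let $p\in\mathbf{P}$ and $\varphi,\psi\in\mathcal{L}$. The following formulas are valid on the class $\mathfrak{M}^\bullet$ (i.e., belong to SLL): (a) $p\to\Box_L[-]_1p$; (b) $p\land\Diamond_L\top\to\Diamond_L[-]_1p$; (c) $p\to\bigcirc p$ for $\bigcirc\in\{[-]_2,[+]\}$; (d) $\bigcirc(\varphi\to\psi)\to(\bigcirc\varphi\to\bigcirc\psi)$ for $\bigcirc\in\{[-]_2,[+]\}$; (e) $\Box_L^n[-]_1(\varphi\to\psi)\to(\Box_L^n[-]_1\varphi\to\Box_L^n[-]_1\psi)$ for $n\in\mathbb{N}$; (f) $\Box_L^n\langle-\rangle_1\varphi\to\Box_L^{n+m}\langle-\rangle_1\varphi$ for $n,m\in\mathbb{N}$; (g) $\Diamond_L^n\langle-\rangle_1\varphi\to\bigvee_{m<n}\Diamond_L^m\langle-\rangle_2\varphi$ for $1\le n\in\mathbb{N}$.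
   Context: Fix a countable set $\mathbf{P}$ of atoms. The language $\mathcal{L}$ of SLL is $\varphi::=p\mid\neg\varphi\mid(\varphi\land\varphi)\mid\Diamond_L\varphi\mid\langle-\rangle_1\varphi\mid\langle-\rangle_2\varphi\mid\langle+\rangle\varphi$, where $\Diamond_L$ is the learner-move modality (drawn as a black diamond in the paper), and $\Box_L,[-]_1,[-]_2,[+]$ are the duals of $\Diamond_L,\langle-\rangle_1,\langle-\rangle_2,\langle+\rangle$; $\top$ and $\to,\lor$ are as usual. A model is $\mathcal{M}=\langle W,R_1,R_2,V\rangle$ with $W\neq\emptyset$, $R_1,R_2\subseteq W^2$, $V:\mathbf{P}\to2^W$. For a finite non-empty sequence $S=\langle w_0,\dots,w_n\rangle$: $e(S)=w_n$; $Set(S)=\{\langle w_i,w_{i+1}\rangle\mid i<n\}$ ($\emptyset$ if singleton); for $\langle w_i,w_{i+1}\rangle\in Set(S)$, $S|_{\langle w_i,w_{i+1}\rangle}=\langle w_0,\dots,w_u\rangle$ where $u$ is the least index with $\langle w_u,w_{u+1}\rangle=\langle w_i,w_{i+1}\rangle$; $S;v$ is $S$ extended by $v$. A pointed model $\langle\mathcal{M},S\rangle$ requires $Set(S)\subseteq R_1$; $\mathfrak{M}^\bullet$ is the class of pointed models whose sequence is a singleton. $\mathcal{M}\ominus\langle v,v'\rangle$ / $\mathcal{M}\oplus\langle v,v'\rangle$ remove / add $\langle v,v'\rangle$ from / to $R_1$. Semantics: $\mathcal{M},S\models p$ iff $e(S)\in V(p)$; Booleans as usual; $\Diamond_L\varphi$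 iff there is $v$ with $R_1e(S)v$ and $\mathcal{M},S;v\models\varphi$; $\langle-\rangle_1\varphi$ iff there is $\langle v,v'\rangle\in Set(S)\setminus R_2$ with $\mathcal{M}\ominus\langle v,v'\rangle,S|_{\langle v,v'\rangle}\models\varphi$; $\langle-\rangle_2\varphi$ iff there is $\langle v,v'\rangle\in(R_1\setminus R_2)\setminus Set(S)$ with $\mathcal{M}\ominus\langle v,v'\rangle,S\models\varphi$; $\langle+\rangle\varphi$ iff there is $\langle v,v'\rangle\in R_2\setminus R_1$ with $\mathcal{M}\oplus\langle v,v'\rangle,S\models\varphi$. SLL is the set of $\mathcal{L}$-formulas valid on $\mathfrak{M}^\bullet$. -}

module Defs where

open import Data.Nat using (ℕ; zero; suc; _+_)
open import Data.Product using (Σ; _×_; _,_)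
open import Data.Sum using (_⊎_)
open import Data.Empty using (⊥)
open import Relation.Nullary using (¬_)
open import Relation.Binary.PropositionalEquality using (_≡_)

Atom : Set
Atom = ℕ

data Form : Set where
  atom  : Atom → Form
  ¬'_   : Form → Form
  _∧'_  : Form → Form → Form
  ◆L    : Form → Form
  ⟨-⟩₁  : Form → Form
  ⟨-⟩₂  : Form → Form
  ⟨+⟩   : Form → Form

infixr 6 _∧'_
infixr 5 _∨'_
infixr 4 _⇒'_

⊤' : Form
⊤' = ¬' (atom 0 ∧' ¬' atom 0)

⊥' : Form
⊥' = ¬' ⊤'

_∨'_ : Form → Form → Form
φ ∨' ψ = ¬' (¬' φ ∧' ¬' ψ)

_⇒'_ : Form → Form → Form
φ ⇒' ψ = ¬' (φ ∧' ¬' ψ)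

□L [-]₁ [-]₂ [+] : Form → Form
□L φ   = ¬' ◆L (¬' φ)
[-]₁ φ = ¬' ⟨-⟩₁ (¬' φ)
[-]₂ φ = ¬' ⟨-⟩₂ (¬' φ)
[+] φ  = ¬' ⟨+⟩ (¬' φ)

◆L^ : ℕ → Form → Form
◆L^ zero φ    = φ
◆L^ (suc n) φ = ◆L (◆L^ n φ)

□L^ : ℕ → Form → Form
□L^ zero φ    = φ
□L^ (suc n) φ = □L (□L^ n φ)

⋁< : ℕ → (ℕ → Form) → Form
⋁< zero f    = ⊥'
⋁< (suc n) f = ⋁< n f ∨' f n

-- Models ⟨W, R₁, R₂, V⟩ (W non-empty is ensured by the pointed singleton).
record Model : Set₁ where
  constructor mkModel
  field
    W  : Set
    R₁ : W → W → Set
    R₂ : W → W → Set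
    V  : Atom → W → Set
open Model public

_⊖_ : (M : Model) → W M × W M → Model
M ⊖ (v , v') = mkModel (W M) (λ x y → R₁ M x y × ¬ (x ≡ v × y ≡ v')) (R₂ M) (V M)

_⊕_ : (M : Model) → W M × W M → Model
M ⊕ (v , v') = mkModel (W M) (λ x y → R₁ M x y ⊎ (x ≡ v × y ≡ v')) (R₂ M) (V M)

data Seq (A : Set) : Set where
  [_] : A → Seq A
  _︔_ : Seq A → A → Seq A

module _ {A : Set} where
  e : Seq A → A
  e [ w ]   = w
  e (S ︔ w) = w

  InSet : Seq A → A → A → Set
  InSet [ w ]   a b = ⊥
  InSet (S ︔ w) a b = (e S ≡ a × w ≡ b) ⊎ InSet S a b

  -- Restr S a b T : T = S|_{⟨a,b⟩}, the prefix ⟨w₀,…,w_u⟩ of S with u the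
  -- least index such that ⟨w_u,w_{u+1}⟩ = ⟨a,b⟩.
  data Restr : Seq A → A → A → Seq A → Set where
    later : ∀ {S w a b T} → InSet S a b → Restr S a b T → Restr (S ︔ w) a b T
    first : ∀ {S w a b} → e S ≡ a → w ≡ b → ¬ InSet S a b → Restr (S ︔ w) a b S

_,_⊨_ : (M : Model) → Seq (W M) → Form → Set
M , S ⊨ atom p   = V M p (e S)
M , S ⊨ (¬' φ)   = ¬ (M , S ⊨ φ)
M , S ⊨ (φ ∧' ψ) = (M , S ⊨ φ) × (M , S ⊨ ψ)
M , S ⊨ ◆L φ     = Σ (W M) λ v → R₁ M (e S) v × (M , (S ︔ v) ⊨ φ)
M , S ⊨ ⟨-⟩₁ φ   = Σ (W M) λ v → Σ (W M) λ v' →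
  InSet S v v' × ¬ R₂ M v v' ×
  Σ (Seq (W M)) λ T → Restr S v v' T × ((M ⊖ (v , v')) , T ⊨ φ)
M , S ⊨ ⟨-⟩₂ φ   = Σ (W M) λ v → Σ (W M) λ v' →
  (R₁ M v v' × ¬ R₂ M v v') × ¬ InSet S v v' × ((M ⊖ (v , v')) , S ⊨ φ)
M , S ⊨ ⟨+⟩ φ    = Σ (W M) λ v → Σ (W M) λ v' →
  (R₂ M v v' × ¬ R₁ M v v') × ((M ⊕ (v , v')) , S ⊨ φ)

-- Validity on the class 𝔐• of pointed models with singleton sequence.
Valid : Form → Set₁
Valid φ = (M : Model) (w : W M) → M , [ w ] ⊨ φ

-- Deleting or adding an R₁-edge never changes the valuation, and ⟨-⟩₂, ⟨+⟩
-- keep the sequence, so atoms are invariant under them; every box is normal.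
-- At ⟨w⟩;v the only edge is ⟨w,v⟩ and its restriction is ⟨w⟩, which gives
-- (a) and (b).  An edge of S is still an edge of S;v with the same
-- restriction, which gives (f).  Conversely an edge of S;v is either an edge
-- of S or the new edge ⟨e(S),v⟩ ∈ R₁ \ Set(S) with restriction S, whose
-- deletion is then a ⟨-⟩₂-move at S.  Peeling off the learner moves one at a
-- time thus turns ◆L^n ⟨-⟩₁ φ into ◆L^m ⟨-⟩₂ φ with m < n, or into ⟨-⟩₁ φ
-- at the starting point, which is impossible at a singleton: this is (g).
module Submission where

open import Defs
open import Data.Nat using (ℕ; zero; suc; _+_; _≤_; _<_; z≤n; s≤s)
open import Data.Nat.Properties using (m<1+n⇒m<n∨m≡n)
open import Data.Product using (_×_; Σ; _,_)
open import Data.Sum using (_⊎_; inj₁; inj₂)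
open import Function using (case_of_)
open import Relation.Binary.PropositionalEquality using (_≡_; refl; sym; cong; subst)

⋁<-intro : ∀ {M S m} n (f : ℕ → Form) → m < n → M , S ⊨ f m → M , S ⊨ ⋁< n f
⋁<-intro (suc n) f m<1+n sfm with m<1+n⇒m<n∨m≡n m<1+n
... | inj₁ m<n  = λ (¬s⋁ , _) → ¬s⋁ (⋁<-intro n f m<n sfm)
... | inj₂ refl = λ (_ , ¬sfm) → ¬sfm sfm

[-]₂-atom : ∀ {M S} p → M , S ⊨ atom p → M , S ⊨ [-]₂ (atom p)
[-]₂-atom p sp (_ , _ , _ , _ , ¬sp) = ¬sp sp

[+]-atom : ∀ {M S} p → M , S ⊨ atom p → M , S ⊨ [+] (atom p)
[+]-atom p sp (_ , _ , _ , ¬sp) = ¬sp sp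

⟨-⟩₁-first-move : ∀ {M w v} φ →
  M , ([ w ] ︔ v) ⊨ ⟨-⟩₁ φ → (M ⊖ (w , v)) , [ w ] ⊨ φ
⟨-⟩₁-first-move φ (_ , _ , inj₁ (refl , refl) , _ , _ , first _ _ _ , sφ) = sφ

[-]₁-atom-first-move : ∀ {M w v} p →
  M , [ w ] ⊨ atom p → M , ([ w ] ︔ v) ⊨ [-]₁ (atom p)
[-]₁-atom-first-move {M} p sp s⟨-⟩₁ = ⟨-⟩₁-first-move {M} (¬' atom p) s⟨-⟩₁ sp

[-]₁-K : ∀ {M S} φ ψ →
  M , S ⊨ [-]₁ (φ ⇒' ψ) → M , S ⊨ [-]₁ φ → M , S ⊨ [-]₁ ψ
[-]₁-K φ ψ □φ⇒ψ □φ (a , b , i , ¬r , T , res , ¬sψ) =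
  □φ (a , b , i , ¬r , T , res , λ sφ →
    □φ⇒ψ (a , b , i , ¬r , T , res , λ sφ⇒ψ → sφ⇒ψ (sφ , ¬sψ)))

[-]₂-K : ∀ {M S} φ ψ →
  M , S ⊨ [-]₂ (φ ⇒' ψ) → M , S ⊨ [-]₂ φ → M , S ⊨ [-]₂ ψ
[-]₂-K φ ψ □φ⇒ψ □φ (a , b , r , ¬i , ¬sψ) =
  □φ (a , b , r , ¬i , λ sφ → □φ⇒ψ (a , b , r , ¬i , λ sφ⇒ψ → sφ⇒ψ (sφ , ¬sψ)))

[+]-K : ∀ {M S} φ ψ →
  M , S ⊨ [+] (φ ⇒' ψ) → M , S ⊨ [+] φ → M , S ⊨ [+] ψ
[+]-K φ ψ □φ⇒ψ □φ (a , b , r , ¬sψ) =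
  □φ (a , b , r , λ sφ → □φ⇒ψ (a , b , r , λ sφ⇒ψ → sφ⇒ψ (sφ , ¬sψ)))

module _ {M : Model} where

  □L^-K : ∀ {φ χ ψ} → (∀ {T} → M , T ⊨ φ → M , T ⊨ χ → M , T ⊨ ψ) →
    ∀ n {S} → M , S ⊨ □L^ n φ → M , S ⊨ □L^ n χ → M , S ⊨ □L^ n ψ
  □L^-K f zero    sφ sχ = f sφ sχ
  □L^-K f (suc n) □φ □χ (v , r , ¬sψ) =
    □φ (v , r , λ sφ → □χ (v , r , λ sχ → ¬sψ (□L^-K f n sφ sχ)))

  □L^-mono : ∀ {φ ψ} → (∀ {T} → M , T ⊨ φ → M , T ⊨ ψ) →
    ∀ n {S} → M , S ⊨ □L^ n φ → M , S ⊨ □L^ n ψ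
  □L^-mono f n sφ = □L^-K (λ sφ _ → f sφ) n sφ sφ

□L^-+ : ∀ n m φ → □L^ (n + m) φ ≡ □L^ n (□L^ m φ)
□L^-+ zero    m φ = refl
□L^-+ (suc n) m φ = cong □L (□L^-+ n m φ)

⟨-⟩₁-extend : ∀ {M S v} φ → M , S ⊨ ⟨-⟩₁ φ → M , (S ︔ v) ⊨ ⟨-⟩₁ φ
⟨-⟩₁-extend φ (a , b , i , ¬r , T , res , sφ) = a , b , inj₂ i , ¬r , T , later i res , sφ

⟨-⟩₁⇒□L^⟨-⟩₁ : ∀ {M} φ m {S} → M , S ⊨ ⟨-⟩₁ φ → M , S ⊨ □L^ m (⟨-⟩₁ φ)
⟨-⟩₁⇒□L^⟨-⟩₁ φ zero    s = s
⟨-⟩₁⇒□L^⟨-⟩₁ φ (suc m) s (v , _ , ¬s) = ¬s (⟨-⟩₁⇒□L^⟨-⟩₁ φ m (⟨-⟩₁-extend φ s))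

⟨-⟩₁-retract : ∀ {M S v} φ → R₁ M (e S) v →
  M , (S ︔ v) ⊨ ⟨-⟩₁ φ → M , S ⊨ ⟨-⟩₁ φ ⊎ M , S ⊨ ⟨-⟩₂ φ
⟨-⟩₁-retract φ _ (a , b , _ , ¬r , T , later i res , sφ) = inj₁ (a , b , i , ¬r , T , res , sφ)
⟨-⟩₁-retract φ r (a , b , _ , ¬r , _ , first refl refl ¬i , sφ) = inj₂ (a , b , (r , ¬r) , ¬i , sφ)

◆L^⟨-⟩₁-retract : ∀ {M} φ n {S} → M , S ⊨ ◆L^ n (⟨-⟩₁ φ) →
  M , S ⊨ ⟨-⟩₁ φ ⊎ Σ ℕ λ m → m < n × M , S ⊨ ◆L^ m (⟨-⟩₂ φ)
◆L^⟨-⟩₁-retract φ zero    s = inj₁ s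
◆L^⟨-⟩₁-retract φ (suc n) (v , r , s) with ◆L^⟨-⟩₁-retract φ n s
... | inj₂ (m , m<n , s◆) = inj₂ (suc m , s≤s m<n , v , r , s◆)
... | inj₁ s⟨-⟩₁ with ⟨-⟩₁-retract φ r s⟨-⟩₁
...   | inj₁ s⟨-⟩₁′ = inj₁ s⟨-⟩₁′
...   | inj₂ s⟨-⟩₂  = inj₂ (zero , s≤s z≤n , s⟨-⟩₂)

¬⟨-⟩₁-singleton : ∀ {M w} φ → M , [ w ] ⊨ (¬' ⟨-⟩₁ φ)
¬⟨-⟩₁-singleton φ (_ , _ , () , _)

proposition4 : (p : Atom) (φ ψ : Form) →
      Valid (atom p ⇒' □L ([-]₁ (atom p)))
    × Valid ((atom p ∧' ◆L ⊤') ⇒' ◆L ([-]₁ (atom p)))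
    × Valid (atom p ⇒' [-]₂ (atom p))
    × Valid (atom p ⇒' [+] (atom p))
    × Valid ([-]₂ (φ ⇒' ψ) ⇒' ([-]₂ φ ⇒' [-]₂ ψ))
    × Valid ([+] (φ ⇒' ψ) ⇒' ([+] φ ⇒' [+] ψ))
    × ((n : ℕ) → Valid (□L^ n ([-]₁ (φ ⇒' ψ)) ⇒' (□L^ n ([-]₁ φ) ⇒' □L^ n ([-]₁ ψ))))
    × ((n m : ℕ) → Valid (□L^ n (⟨-⟩₁ φ) ⇒' □L^ (n + m) (⟨-⟩₁ φ)))
    × ((n : ℕ) → 1 ≤ n → Valid (◆L^ n (⟨-⟩₁ φ) ⇒' ⋁< n (λ m → ◆L^ m (⟨-⟩₂ φ))))
proposition4 p φ ψ =
    (λ M w (sp , ¬s□) → ¬s□ λ (v , _ , ¬s) → ¬s ([-]₁-atom-first-move {M} p sp))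
  , (λ M w ((sp , v , r , _) , ¬s◆) → ¬s◆ (v , r , [-]₁-atom-first-move {M} p sp))
  , (λ M w (sp , ¬s□) → ¬s□ ([-]₂-atom {M} {[ w ]} p sp))
  , (λ M w (sp , ¬s□) → ¬s□ ([+]-atom {M} {[ w ]} p sp))
  , (λ M w (□φ⇒ψ , ¬s) → ¬s λ (□φ , ¬□ψ) → ¬□ψ ([-]₂-K φ ψ □φ⇒ψ □φ))
  , (λ M w (□φ⇒ψ , ¬s) → ¬s λ (□φ , ¬□ψ) → ¬□ψ ([+]-K φ ψ □φ⇒ψ □φ))
  , (λ n M w (□φ⇒ψ , ¬s) → ¬s λ (□φ , ¬□ψ) → ¬□ψ (□L^-K ([-]₁-K φ ψ) n □φ⇒ψ □φ))
  , (λ n m M w (□⟨-⟩₁ , ¬s) → ¬s (subst (M , [ w ] ⊨_) (sym (□L^-+ n m (⟨-⟩₁ φ)))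
                                   (□L^-mono (⟨-⟩₁⇒□L^⟨-⟩₁ φ m) n □⟨-⟩₁)))
  , (λ n _ M w (◆⟨-⟩₁ , ¬s) → case ◆L^⟨-⟩₁-retract φ n ◆⟨-⟩₁ of λ where
       (inj₁ s⟨-⟩₁)          → ¬⟨-⟩₁-singleton φ s⟨-⟩₁
       (inj₂ (m , m<n , s◆)) → ¬s (⋁<-intro n (λ m → ◆L^ m (⟨-⟩₂ φ)) m<n s◆))
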